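{- Let $n$ be a prime. Then $p_{\leq n}(n)=p_{\leq n-1}(n-1)+1$, where for a positive integer $m$, $p_{\leq m}(m)$ denotes the number of partitions of $m$ whose product of summands is at most $m$.
   Context: A partition of a non-negative integer $n$ is a representation of $n$ as a sum of unordered positive integers (its parts or summands). The product of the summands of a partition is the product of all its parts counted with multiplicity. -}

module Defs where

open import Data.Bool using (if_then_else_)
open import Data.Nat using (ℕ; zero; suc; _+_; _*_; _≤_; _≤?_; _∸_; _≤ᵇ_)
open import Data.List using (List; []; _∷_; map; concatMap; length; filter; upTo)
open import Data.Nat.ListAction using (product)

-- A partition of m is represented canonically as a non-increasing list of
-- positive integers summing to m (parts unordered, listed largest first).
-- partsAtMostF fuel k m : all partitions of m whose parts are all ≤ k,
-- each listed exactly once.  The largest part is some j with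
-- 1 ≤ j ≤ min k m, followed by a partition of m ∸ j into parts ≤ j.
-- Fuel (initialised to m) bounds the recursion depth; each step
-- decreases m by at least 1, so fuel m is always sufficient.
partsAtMostF : ℕ → ℕ → ℕ → List (List ℕ)
partsAtMostF _        k zero    = [] ∷ []
partsAtMostF zero     k (suc m) = []
partsAtMostF (suc f)  k (suc m) =
  concatMap (λ i → if suc i ≤ᵇ k
                   then map (suc i ∷_) (partsAtMostF f (suc i) (suc m ∸ suc i))
                   else [])
            (upTo (suc m))

partitions : ℕ → List (List ℕ)
partitions m = partsAtMostF m m m

pLeq : ℕ → ℕ
pLeq m = length (filter (λ parts → product parts ≤? m) (partitions m))

{-# OPTIONS --safe #-}
-- Split the partitions of the prime n according to whether they contain a part 1.
-- Deleting one part 1 is a bijection onto the partitions of n - 1 preserving the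
-- product, and since a product of parts smaller than n is never the prime n, the
-- condition "product ≤ n" there is the same as "product ≤ n - 1".  A partition of n
-- without a part 1 has product ≥ sum = n, with equality only for the partition n itself.
module Submission where

open import Defs
open import Data.Nat using (ℕ; suc; _+_; _∸_)
open import Data.Nat.Primality using (Prime)
open import Relation.Binary.PropositionalEquality using (_≡_)

open import Level using (Level)
open import Function using (_∘_; id; _⇔_; mk⇔; Equivalence)
open import Data.Bool using (true; false; if_then_else_)
open import Data.Bool.Properties using (T-≡)
open import Data.Product using (_×_; _,_; proj₁; proj₂)
open import Data.Sum using (inj₁; inj₂)
open import Data.Nat using (zero; _*_; _≤_; _<_; _≤?_; _≤ᵇ_; _≟_; z≤n; s≤s; s≤s⁻¹)
open import Data.Nat.Properties
open import Data.Nat.ListAction using (sum; product)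
open import Data.Nat.ListAction.Properties using (product-++)
open import Data.Nat.Divisibility using (_∣_; m∣m*n)
open import Data.Nat.Primality using (prime⇒irreducible; ¬prime[0]; ¬prime[1])
open import Data.List
  using (List; []; _∷_; _++_; _∷ʳ_; [_]; map; concat; concatMap; length; filter; upTo; replicate)
open import Data.List.Properties
  using (length-++; filter-++; filter-none; filter-accept; upTo-∷ʳ; concatMap-++; ++-identityʳ; map-cong-local)
open import Data.List.Relation.Unary.All as All using (All; []; _∷_)
open import Data.List.Relation.Unary.All.Properties
  using (concat⁺; map⁺; applyUpTo⁺₁; applyUpTo⁺₂)
open import Data.List.Relation.Unary.Any using (here; there)
open import Data.List.Membership.Propositional using (_∈_)
open import Data.List.Membership.DecPropositional _≟_ using (_∈?_)
open import Relation.Nullary using (¬_; yes; no; contradiction)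
open import Relation.Unary using (Pred; Decidable; ∁)
open import Relation.Unary.Properties using (∁?; _∩?_)
open import Relation.Binary.PropositionalEquality
  using (_≢_; refl; sym; trans; cong; cong₂; subst; ≢-sym; module ≡-Reasoning)

private variable
  ℓ ℓ′ p q r : Level
  A : Set ℓ
  B : Set ℓ′

count : {P : Pred A p} → Decidable P → List A → ℕ
count P? = length ∘ filter P?

module _ {P : Pred A p} (P? : Decidable P) where

  count-++ : ∀ xs ys → count P? (xs ++ ys) ≡ count P? xs + count P? ys
  count-++ xs ys = trans (cong length (filter-++ P? xs ys)) (length-++ (filter P? xs))

  count-none : ∀ {xs} → All (∁ P) xs → count P? xs ≡ 0
  count-none = cong length ∘ filter-none P?

  count-[_] : ∀ {x} → P x → count P? [ x ] ≡ 1
  count-[_] = cong length ∘ filter-accept P?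

  count-map : (f : B → A) → ∀ xs → count P? (map f xs) ≡ count (P? ∘ f) xs
  count-map f [] = refl
  count-map f (x ∷ xs) with P? (f x)
  ... | yes _ = cong suc (count-map f xs)
  ... | no  _ = count-map f xs

  count-split : {Q : Pred A q} (Q? : Decidable Q) →
                ∀ xs → count P? xs ≡ count (Q? ∩? P?) xs + count (∁? Q? ∩? P?) xs
  count-split Q? [] = refl
  count-split Q? (x ∷ xs) with Q? x | P? x
  ... | yes _ | yes _ = cong suc (count-split Q? xs)
  ... | no  _ | yes _ = trans (cong suc (count-split Q? xs)) (sym (+-suc _ _))
  ... | yes _ | no  _ = count-split Q? xs
  ... | no  _ | no  _ = count-split Q? xs

  count-concatMap-upTo-suc : (g : ℕ → List A) → ∀ n →
    count P? (concatMap g (upTo (suc n))) ≡ count P? (concatMap g (upTo n)) + count P? (g n)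
  count-concatMap-upTo-suc g n = begin
    count P? (concatMap g (upTo (suc n)))
      ≡⟨ cong (count P? ∘ concatMap g) (upTo-∷ʳ n) ⟨
    count P? (concatMap g (upTo n ++ [ n ]))
      ≡⟨ cong (count P?) (concatMap-++ g (upTo n) [ n ]) ⟩
    count P? (concatMap g (upTo n) ++ (g n ++ []))
      ≡⟨ count-++ (concatMap g (upTo n)) (g n ++ []) ⟩
    count P? (concatMap g (upTo n)) + count P? (g n ++ [])
      ≡⟨ cong ((count P? (concatMap g (upTo n)) +_) ∘ count P?) (++-identityʳ (g n)) ⟩
    count P? (concatMap g (upTo n)) + count P? (g n) ∎
    where open ≡-Reasoning

module _ {P : Pred A p} {Q : Pred A q} (P? : Decidable P) (Q? : Decidable Q) where

  count-cong : ∀ {xs} → All (λ x → P x ⇔ Q x) xs → count P? xs ≡ count Q? xs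
  count-cong {[]}     []           = refl
  count-cong {x ∷ xs} (P⇔Q ∷ eqs) with P? x | Q? x
  ... | yes _  | yes _  = cong suc (count-cong eqs)
  ... | no  _  | no  _  = count-cong eqs
  ... | yes px | no ¬qx = contradiction (Equivalence.to P⇔Q px) ¬qx
  ... | no ¬px | yes qx = contradiction (Equivalence.from P⇔Q qx) ¬px

  count-concatMap-upTo-cong : (g h : ℕ → List A) → ∀ n →
    (∀ {i} → i < n → count P? (g i) ≡ count Q? (h i)) →
    count P? (concatMap g (upTo n)) ≡ count Q? (concatMap h (upTo n))
  count-concatMap-upTo-cong g h zero    _  = refl
  count-concatMap-upTo-cong g h (suc n) eq = begin
    count P? (concatMap g (upTo (suc n)))
      ≡⟨ count-concatMap-upTo-suc P? g n ⟩
    count P? (concatMap g (upTo n)) + count P? (g n)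
      ≡⟨ cong₂ _+_ (count-concatMap-upTo-cong g h n (eq ∘ m<n⇒m<1+n)) (eq (n<1+n n)) ⟩
    count Q? (concatMap h (upTo n)) + count Q? (h n)
      ≡⟨ count-concatMap-upTo-suc Q? h n ⟨
    count Q? (concatMap h (upTo (suc n))) ∎
    where open ≡-Reasoning

count-∩?-[_,_] : {P : Pred A p} {Q : Pred A q} (P? : Decidable P) (Q? : Decidable Q) →
                 ∀ {x} → P x → count (P? ∩? Q?) [ x ] ≡ count Q? [ x ]
count-∩?-[ P? , Q? ] px = count-cong (P? ∩? Q?) Q? (mk⇔ proj₂ (px ,_) ∷ [])

concat-[] : ∀ {xss : List (List A)} → All (_≡ []) xss → concat xss ≡ []
concat-[] []         = refl
concat-[] (refl ∷ e) = concat-[] e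

replicate-∷ʳ : ∀ n (x : A) → replicate n x ∷ʳ x ≡ x ∷ replicate n x
replicate-∷ʳ zero    x = refl
replicate-∷ʳ (suc n) x = cong (x ∷_) (replicate-∷ʳ n x)

m+n≤m*n : ∀ {m n} → 2 ≤ m → 2 ≤ n → m + n ≤ m * n
m+n≤m*n (s≤s (s≤s (z≤n {n = m}))) 2≤n@(s≤s (s≤s (z≤n {n = k}))) = begin
  2 + m + (2 + k)              ≡⟨ +-comm (2 + m) (2 + k) ⟩
  2 + k + (2 + m)              ≤⟨ +-monoʳ-≤ (2 + k) (+-mono-≤ 2≤n (m≤m*n m (2 + k))) ⟩
  2 + k + (2 + k + m * (2 + k)) ∎
  where open ≤-Reasoning

sum≤product : ∀ {ps} → All (2 ≤_) ps → sum ps ≤ product ps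
sum≤product []         = z≤n
sum≤product {a ∷ []} _ = ≤-reflexive (trans (+-identityʳ a) (sym (*-identityʳ a)))
sum≤product {a ∷ ps@(b ∷ _)} (2≤a ∷ 2≤ps@(2≤b ∷ _)) with sum≤product 2≤ps
... | ih = begin
  a + sum ps       ≤⟨ +-monoʳ-≤ a ih ⟩
  a + product ps   ≤⟨ m+n≤m*n 2≤a (≤-trans 2≤b (≤-trans (m≤m+n b _) ih)) ⟩
  a * product ps   ∎
  where open ≤-Reasoning

product≢prime : ∀ {n ps} → Prime n → All (_< n) ps → product ps ≢ n
product≢prime pr [] 1≡n = ¬prime[1] (subst Prime (sym 1≡n) pr)
product≢prime {ps = a ∷ ps} pr (a<n ∷ ps<n) eq
  with prime⇒irreducible pr (subst (a ∣_) eq (m∣m*n (product ps)))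
... | inj₁ refl = product≢prime pr ps<n (trans (sym (+-identityʳ _)) eq)
... | inj₂ refl = <-irrefl refl a<n

product-∷ʳ-1 : ∀ ps → product (ps ∷ʳ 1) ≡ product ps
product-∷ʳ-1 ps = trans (product-++ ps [ 1 ]) (*-identityʳ (product ps))

prime<product : ∀ {n ps} → Prime n → All (λ x → 2 ≤ x × x < n) ps → sum ps ≡ n →
                n < product ps
prime<product pr bounds sum≡n =
  ≤∧≢⇒< (subst (_≤ _) sum≡n (sum≤product (All.map proj₁ bounds)))
        (≢-sym (product≢prime pr (All.map proj₂ bounds)))

BoundedPartition : ℕ → ℕ → List ℕ → Set
BoundedPartition k m ps = sum ps ≡ m × All (λ x → 1 ≤ x × x ≤ k) ps

prime<product-of-partition : ∀ {n k ps} → Prime n → k < n →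
  BoundedPartition k n ps → ¬ 1 ∈ ps → n < product ps
prime<product-of-partition {n} {ps = ps} pr k<n (sum≡n , bounds) 1∉ps =
  prime<product pr (All.tabulate parts) sum≡n
  where
  parts : ∀ {x} → x ∈ ps → 2 ≤ x × x < n
  parts {x} x∈ps with All.lookup bounds x∈ps
  ... | 1≤x , x≤k =
    ≤∧≢⇒< 1≤x (λ 1≡x → 1∉ps (subst (_∈ _) (sym 1≡x) x∈ps)) , ≤-<-trans x≤k k<n

-- partsAtMostF (suc f) k (suc m) unfolds to
-- concatMap (withLargestPart f k (suc m)) (upTo (suc m)).
withLargestPart : ℕ → ℕ → ℕ → ℕ → List (List ℕ)
withLargestPart f k m i =
  if suc i ≤ᵇ k then map (suc i ∷_) (partsAtMostF f (suc i) (m ∸ suc i)) else []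

withLargestPart-≤ : ∀ {f k m i} → suc i ≤ k →
  withLargestPart f k m i ≡ map (suc i ∷_) (partsAtMostF f (suc i) (m ∸ suc i))
withLargestPart-≤ le rewrite Equivalence.to T-≡ (≤⇒≤ᵇ le) = refl

withLargestPart-≰ : ∀ {f k m i} → ¬ suc i ≤ k → withLargestPart f k m i ≡ []
withLargestPart-≰ {k = k} {i = i} ≰ with suc i ≤ᵇ k in eq
... | false = refl
... | true  = contradiction (≤ᵇ⇒≤ (suc i) k (Equivalence.from T-≡ eq)) ≰

∷-boundedPartition : ∀ {i k m ps} → suc i ≤ m → suc i ≤ k →
  BoundedPartition (suc i) (m ∸ suc i) ps → BoundedPartition k m (suc i ∷ ps)
∷-boundedPartition {i} i<m i<k (sum≡ , bounds) =
  trans (cong (suc i +_) sum≡) (m+[n∸m]≡n i<m) ,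
  (s≤s z≤n , i<k) ∷ All.map (λ (1≤x , x≤i) → 1≤x , ≤-trans x≤i i<k) bounds

partsAtMostF-sound : ∀ f k m → All (BoundedPartition k m) (partsAtMostF f k m)
partsAtMostF-sound f       k zero    = (refl , []) ∷ []
partsAtMostF-sound zero    k (suc m) = []
partsAtMostF-sound (suc f) k (suc m) = concat⁺ (map⁺ (applyUpTo⁺₁ id (suc m) block))
  where
  block : ∀ {i} → i < suc m →
          All (BoundedPartition k (suc m)) (withLargestPart f k (suc m) i)
  block {i} i<m with suc i ≤? k
  ... | no  i≮k rewrite withLargestPart-≰ {f} {k} {suc m} i≮k = []
  ... | yes i<k rewrite withLargestPart-≤ {f} {k} {suc m} i<k =
    map⁺ (All.map (∷-boundedPartition i<m i<k)
                   (partsAtMostF-sound f (suc i) (suc m ∸ suc i)))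

partsAtMostF-≥ : ∀ f {k} m → m ≤ k → partsAtMostF f k m ≡ partsAtMostF f m m
partsAtMostF-≥ f       zero    _   = refl
partsAtMostF-≥ zero    (suc m) _   = refl
partsAtMostF-≥ (suc f) {k} (suc m) m≤k =
  cong concat (map-cong-local (applyUpTo⁺₁ id (suc m) same))
  where
  same : ∀ {i} → i < suc m →
         withLargestPart f k (suc m) i ≡ withLargestPart f (suc m) (suc m) i
  same i≤m = trans (withLargestPart-≤ {f} {k} {suc m} (≤-trans i≤m m≤k))
                   (sym (withLargestPart-≤ {f} {suc m} {suc m} i≤m))

partsAtMostF-1 : ∀ f m → m ≤ f → partsAtMostF f 1 m ≡ [ replicate m 1 ]
partsAtMostF-1 f       zero    _   = refl
partsAtMostF-1 (suc f) (suc m) m≤f =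
  cong₂ _++_ (cong (map (1 ∷_)) (partsAtMostF-1 f m (s≤s⁻¹ m≤f)))
             (concat-[] (map⁺ (applyUpTo⁺₂ suc m (λ _ → refl))))

count-with-1-allOnes : ∀ {R : Pred (List ℕ) r} (R? : Decidable R) {f m} → m ≤ f →
  count ((1 ∈?_) ∩? R?) (map (1 ∷_) (partsAtMostF (suc f) 1 (suc m))) ≡
  count (R? ∘ (_∷ʳ 1)) (map (1 ∷_) (partsAtMostF f 1 m))
count-with-1-allOnes R? {f} {m} m≤f
  rewrite partsAtMostF-1 (suc f) (suc m) (s≤s m≤f) | partsAtMostF-1 f m m≤f = begin
  count ((1 ∈?_) ∩? R?) [ 1 ∷ 1 ∷ replicate m 1 ]
    ≡⟨ count-∩?-[ (1 ∈?_) , R? ] (here refl) ⟩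
  count R? [ 1 ∷ 1 ∷ replicate m 1 ]
    ≡⟨ cong (count R? ∘ [_] ∘ (1 ∷_)) (replicate-∷ʳ m 1) ⟨
  count R? [ 1 ∷ replicate m 1 ∷ʳ 1 ]
    ≡⟨ count-map R? (_∷ʳ 1) [ 1 ∷ replicate m 1 ] ⟩
  count (R? ∘ (_∷ʳ 1)) [ 1 ∷ replicate m 1 ] ∎
  where open ≡-Reasoning

-- Partitions are listed in non-increasing order, so the part 1 to delete is the last one.
-- Following the enumeration by largest part: if it is 1 the partition consists of ones,
-- if it is the whole of m + 1 there is no part 1, and otherwise the 1 lies in the tail.
count-with-1 : ∀ {R : Pred (List ℕ) r} (R? : Decidable R) f {k} m → 1 ≤ k → m ≤ f →
  count ((1 ∈?_) ∩? R?) (partsAtMostF (suc f) k (suc m)) ≡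
  count (R? ∘ (_∷ʳ 1)) (partsAtMostF f k m)
count-with-1 R? f {suc k} zero _ _ =
  trans (count-∩?-[ (1 ∈?_) , R? ] (here refl)) (count-map R? (_∷ʳ 1) [ [] ])
count-with-1 {R = R} R? (suc f) {k} (suc m) _ m≤f = begin
  count X (concatMap (withLargestPart (suc f) k (2 + m)) (upTo (2 + m)))
    ≡⟨ count-concatMap-upTo-suc X (withLargestPart (suc f) k (2 + m)) (suc m) ⟩
  count X (concatMap (withLargestPart (suc f) k (2 + m)) (upTo (suc m)))
    + count X (withLargestPart (suc f) k (2 + m) (suc m))
    ≡⟨ cong₂ _+_ (count-concatMap-upTo-cong X Y (withLargestPart (suc f) k (2 + m))
                    (withLargestPart f k (suc m)) (suc m) sameBlock)
                 largest ⟩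
  count Y (concatMap (withLargestPart f k (suc m)) (upTo (suc m))) + 0
    ≡⟨ +-identityʳ _ ⟩
  count Y (partsAtMostF (suc f) k (suc m)) ∎
  where
  open ≡-Reasoning
  X = (1 ∈?_) ∩? R?
  Y = R? ∘ (_∷ʳ 1)

  largest : count X (withLargestPart (suc f) k (2 + m) (suc m)) ≡ 0
  largest with 2 + m ≤? k
  ... | no  ≰ rewrite withLargestPart-≰ {suc f} {k} {2 + m} ≰ = refl
  ... | yes ≤ rewrite withLargestPart-≤ {suc f} {k} {2 + m} ≤ | n∸n≡0 m = refl

  blockWithLargest : ∀ i → i < suc m →
    count X (map (suc i ∷_) (partsAtMostF (suc f) (suc i) (suc m ∸ i))) ≡
    count Y (map (suc i ∷_) (partsAtMostF f (suc i) (m ∸ i)))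
  blockWithLargest zero _ = count-with-1-allOnes R? (s≤s⁻¹ m≤f)
  blockWithLargest (suc j) j<m = begin
    count X (map (a ∷_) (partsAtMostF (suc f) a (m ∸ j)))
      ≡⟨ count-map X (a ∷_) (partsAtMostF (suc f) a (m ∸ j)) ⟩
    count (X ∘ (a ∷_)) (partsAtMostF (suc f) a (m ∸ j))
      ≡⟨ cong (count (X ∘ (a ∷_)) ∘ partsAtMostF (suc f) a) (+-∸-assoc 1 (s≤s⁻¹ j<m)) ⟩
    count (X ∘ (a ∷_)) (partsAtMostF (suc f) a (suc (m ∸ suc j)))
      ≡⟨ count-cong (X ∘ (a ∷_)) ((1 ∈?_) ∩? (R? ∘ (a ∷_)))
           (All.universal (λ _ → skipLargest) (partsAtMostF (suc f) a (suc (m ∸ suc j)))) ⟩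
    count ((1 ∈?_) ∩? (R? ∘ (a ∷_))) (partsAtMostF (suc f) a (suc (m ∸ suc j)))
      ≡⟨ count-with-1 (R? ∘ (a ∷_)) f (m ∸ suc j) (s≤s z≤n)
                      (≤-trans (m∸n≤m m (suc j)) (s≤s⁻¹ m≤f)) ⟩
    count (R? ∘ (a ∷_) ∘ (_∷ʳ 1)) (partsAtMostF f a (m ∸ suc j))
      ≡⟨ count-map Y (a ∷_) (partsAtMostF f a (m ∸ suc j)) ⟨
    count Y (map (a ∷_) (partsAtMostF f a (m ∸ suc j))) ∎
    where
    a = 2 + j
    skipLargest : ∀ {ps} → (1 ∈ a ∷ ps × R (a ∷ ps)) ⇔ (1 ∈ ps × R (a ∷ ps))
    skipLargest = mk⇔ (λ { (here () , _) ; (there 1∈ps , r) → 1∈ps , r })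
                      (λ (1∈ps , r) → there 1∈ps , r)

  sameBlock : ∀ {i} → i < suc m →
    count X (withLargestPart (suc f) k (2 + m) i) ≡ count Y (withLargestPart f k (suc m) i)
  sameBlock {i} i≤m with suc i ≤? k
  ... | no  ≰ rewrite withLargestPart-≰ {suc f} {k} {2 + m} ≰
                    | withLargestPart-≰ {f} {k} {suc m} ≰ = refl
  ... | yes ≤ rewrite withLargestPart-≤ {suc f} {k} {2 + m} ≤
                    | withLargestPart-≤ {f} {k} {suc m} ≤ =
    blockWithLargest i i≤m

count-product≤-prime : ∀ f {m} → Prime (suc m) →
  count (λ ps → product ps ≤? suc m) (partsAtMostF f m m) ≡
  count (λ ps → product ps ≤? m) (partsAtMostF f m m)
count-product≤-prime f {m} pr = count-cong _ _ (All.map same (partsAtMostF-sound f m m))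
  where
  same : ∀ {ps} → BoundedPartition m m ps → (product ps ≤ suc m) ⇔ (product ps ≤ m)
  same (_ , bounds) = mk⇔
    (λ ≤1+m → s≤s⁻¹ (≤∧≢⇒< ≤1+m (product≢prime pr (All.map (s≤s ∘ proj₂) bounds))))
    m≤n⇒m≤1+n

count-without-1-prime : ∀ {m} → Prime (suc m) →
  count (∁? (1 ∈?_) ∩? (λ ps → product ps ≤? suc m)) (partitions (suc m)) ≡ 1
count-without-1-prime {m} pr = begin
  count X (concatMap (withLargestPart m n n) (upTo n))
    ≡⟨ count-concatMap-upTo-suc X (withLargestPart m n n) m ⟩
  count X (concatMap (withLargestPart m n n) (upTo m)) + count X (withLargestPart m n n m)
    ≡⟨ cong₂ _+_ (count-none X (concat⁺ (map⁺ (applyUpTo⁺₁ id m tooLarge)))) largest ⟩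
  0 + 1 ∎
  where
  open ≡-Reasoning
  n = suc m
  X = ∁? (1 ∈?_) ∩? (λ ps → product ps ≤? n)

  largest : count X (withLargestPart m n n m) ≡ 1
  largest rewrite withLargestPart-≤ {m} {n} {n} (≤-refl {n}) | n∸n≡0 m =
    count-[ X ] {[ n ]} ( (λ { (here 1≡n) → ¬prime[1] (subst Prime (sym 1≡n) pr) })
                        , ≤-reflexive (*-identityʳ n))

  tooLarge : ∀ {i} → i < m → All (∁ _) (withLargestPart m n n i)
  tooLarge {i} i<m rewrite withLargestPart-≤ {m} {n} {n} (m≤n⇒m≤1+n i<m) =
    map⁺ (All.map excluded (partsAtMostF-sound m (suc i) (n ∸ suc i)))
    where
    excluded : ∀ {ps} → BoundedPartition (suc i) (n ∸ suc i) ps →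
               ¬ (¬ 1 ∈ suc i ∷ ps × product (suc i ∷ ps) ≤ n)
    excluded bp (1∉ , product≤n) = <⇒≱ (prime<product-of-partition pr (s≤s i<m)
      (∷-boundedPartition (m≤n⇒m≤1+n i<m) ≤-refl bp) 1∉) product≤n

corollary4 : (n : ℕ) → Prime n → pLeq n ≡ pLeq (n ∸ 1) + 1
corollary4 zero    pr = contradiction pr ¬prime[0]
corollary4 (suc m) pr = begin
  pLeq (suc m)
    ≡⟨ count-split R? (1 ∈?_) (partitions (suc m)) ⟩
  count ((1 ∈?_) ∩? R?) (partitions (suc m))
    + count (∁? (1 ∈?_) ∩? R?) (partitions (suc m))
    ≡⟨ cong₂ _+_ (count-with-1 R? m m (s≤s z≤n) ≤-refl) (count-without-1-prime pr) ⟩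
  count (R? ∘ (_∷ʳ 1)) (partsAtMostF m (suc m) m) + 1
    ≡⟨ cong (_+ 1) (count-cong (R? ∘ (_∷ʳ 1)) R?
                                (All.universal appendOne (partsAtMostF m (suc m) m))) ⟩
  count R? (partsAtMostF m (suc m) m) + 1
    ≡⟨ cong (λ pss → count R? pss + 1) (partsAtMostF-≥ m m (n≤1+n m)) ⟩
  count R? (partitions m) + 1
    ≡⟨ cong (_+ 1) (count-product≤-prime m pr) ⟩
  pLeq m + 1 ∎
  where
  open ≡-Reasoning
  R? = λ ps → product ps ≤? suc m
  appendOne : ∀ ps → (product (ps ∷ʳ 1) ≤ suc m) ⇔ (product ps ≤ suc m)
  appendOne ps = mk⇔ (subst (_≤ suc m) (product-∷ʳ-1 ps))
                     (subst (_≤ suc m) (sym (product-∷ʳ-1 ps)))
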